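{- Let $n\ge m$ and let $Q$ be an $m$-dimensional cube subgraph of $\mathbb{I}_n$. Then there exists a retraction of $\mathcal{N}(\mathbb{I}_n,3)$ onto its subcomplex $\mathcal{N}(Q,3)$.
   Context: For a finite simple connected graph $G$ and a real number $r\ge 0$, the Čech complex $\mathcal{N}(G,r)$ is the simplicial complex with vertex set $V(G)$ in which a finite nonempty set $\sigma\subseteq V(G)$ is a simplex if and only if the closed balls of radius $\frac r2$ centered at the vertices of $\sigma$ have a common point, the balls being taken in the geometric realization of $G$ with the shortest path metric in which each edge is isometric to $[0,1]$. The hypercube graph $\mathbb{I}_n$ has vertex set $\{0,1\}^n$, two vertices adjacent iff they differ in exactly one coordinate. An $m$-dimensional cube subgraph of $\mathbb{I}_n$ is the induced subgraph on the set of vertices whose coordinates at some fixed $n-m$ positions take fixed prescribed values; it is isomorphic to $\mathbb{I}_m$.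
   Formalization: In both Čech complexes, the common point of the balls is sought among vertices and points at rational positions on edges of the geometric realization, rather than at arbitrary real positions in [0,1]. -}

module Defs where

open import Data.Nat using (ℕ; zero; suc; _∸_; _≤_)
open import Data.Bool using (Bool; true; false; _≟_)
open import Data.Vec using (Vec; []; _∷_; lookup)
open import Data.Fin using (Fin)
open import Data.Fin.Subset using (Subset; ∣_∣)
open import Data.Integer using (+_)
open import Data.Rational as ℚ using (ℚ; 0ℚ; 1ℚ; ½; _/_)
open import Data.List using (List; []; _∷_; map)
open import Data.List.Relation.Unary.All using (All)
open import Data.Product using (Σ; ∃; _×_; proj₁)
open import Data.Sum using (_⊎_)
open import Relation.Binary.PropositionalEquality using (_≡_)
open import Relation.Nullary using (Dec; yes; no)

record Graph : Set₁ where
  field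
    V   : Set
    Adj : V → V → Set

open Graph public

data Walk (G : Graph) : V G → V G → ℕ → Set where
  nil  : ∀ {u} → Walk G u u 0
  cons : ∀ {u w v k} → Adj G u w → Walk G w v k → Walk G u v (suc k)

-- Points of the geometric realization |G| (edges isometric to [0,1]).
-- A point is a vertex, or the point at parameter t ∈ [0,1] on an edge
-- {a,b} (at distance t from a and 1 - t from b).

data Point (G : Graph) : Set where
  vtx    : V G → Point G
  onEdge : (a b : V G) → Adj G a b → (t : ℚ) → 0ℚ ℚ.≤ t → t ℚ.≤ 1ℚ → Point G

ℕtoℚ : ℕ → ℚ
ℕtoℚ k = (+ k) / 1

-- Within G v p ρ : the shortest path distance in |G| from vertex v to the
-- point p is at most ρ  (i.e. p lies in the closed ball of radius ρ at v).
Within : (G : Graph) → V G → Point G → ℚ → Set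
Within G v (vtx u) ρ = ∃ λ k → Walk G v u k × (ℕtoℚ k ℚ.≤ ρ)
Within G v (onEdge a b _ t _ _) ρ =
  (∃ λ k → Walk G v a k × (ℕtoℚ k ℚ.+ t ℚ.≤ ρ))
  ⊎ (∃ λ k → Walk G v b k × (ℕtoℚ k ℚ.+ (1ℚ ℚ.- t) ℚ.≤ ρ))

-- Simplices of the Čech complex N(G, r): finite nonempty vertex sets
-- (given as nonempty lists) whose closed balls of radius r/2 share a point.
NonEmpty : {A : Set} → List A → Set
NonEmpty []      = Data.Empty.⊥
  where import Data.Empty
NonEmpty (_ ∷ _) = Data.Unit.⊤
  where import Data.Unit

IsCechSimplex : (G : Graph) → ℚ → List (V G) → Set
IsCechSimplex G r σ =
  NonEmpty σ × ∃ λ (p : Point G) → All (λ v → Within G v p (r ℚ.* ½)) σ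

diffCount : ∀ {n} → Vec Bool n → Vec Bool n → ℕ
diffCount []       []       = 0
diffCount (x ∷ xs) (y ∷ ys) with x ≟ y
... | yes _ = diffCount xs ys
... | no  _ = suc (diffCount xs ys)

Hypercube : ℕ → Graph
Hypercube n = record { V = Vec Bool n ; Adj = λ u v → diffCount u v ≡ 1 }

InCube : ∀ {n} → Subset n → Vec Bool n → Vec Bool n → Set
InCube {n} fixed val v = (i : Fin n) → lookup fixed i ≡ true → lookup v i ≡ lookup val i

CubeSubgraph : ∀ {n} → Subset n → Vec Bool n → Graph
CubeSubgraph {n} fixed val = record
  { V   = Σ (Vec Bool n) (InCube fixed val)
  ; Adj = λ u w → Adj (Hypercube n) (proj₁ u) (proj₁ w) }

record CubeRetraction {n} (fixed : Subset n) (val : Vec Bool n) (r : ℚ) : Set where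
  field
    f          : Vec Bool n → V (CubeSubgraph fixed val)
    simplicial : (σ : List (Vec Bool n)) →
                 IsCechSimplex (Hypercube n) r σ →
                 IsCechSimplex (CubeSubgraph fixed val) r (map f σ)
    retract    : (q : V (CubeSubgraph fixed val)) → proj₁ (f (proj₁ q)) ≡ proj₁ q

module Submission where

-- Projecting onto the cube Q (overwrite the fixed coordinates with their prescribed values)
-- is a retraction of I_n onto Q that sends every edge either to an edge or to a single
-- vertex. Such a map never lengthens walks, so it extends to the geometric realizations
-- (an edge goes linearly onto its image edge, or is collapsed to a point) without moving
-- any point farther from the image of a vertex. Hence balls of radius r/2 with a common
-- point are sent into balls with a common point: the projection is simplicial on the
-- Čech complexes for every r, in particular for r = 3.

open import Defs
open import Axiom.UniquenessOfIdentityProofs using (module Decidable⇒UIP)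
open import Data.Bool using (Bool; true; false; if_then_else_)
import Data.Bool as Bool
open import Data.Empty using (⊥-elim)
import Data.Fin as Fin
open import Data.Fin.Subset using (Subset; ∣_∣)
open import Data.Integer using (+_)
import Data.Integer as ℤ
import Data.Integer.Properties as ℤ
open import Data.List using (_∷_; map)
import Data.List.Relation.Unary.All as All
open import Data.List.Relation.Unary.All.Properties using (map⁺)
open import Data.Nat using (ℕ; suc; _≤_; _∸_; z≤n; s≤s)
import Data.Nat.Coprimality as Coprimality
open import Data.Nat.Properties using (≤-refl; ≤-trans; m≤n⇒m≤1+n; n≤1⇒n≡0∨n≡1)
open import Data.Product using (∃; _×_; _,_)
open import Data.Rational as ℚ using (ℚ; mkℚ; 0ℚ; 1ℚ; _/_)
import Data.Rational.Properties as ℚ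
open import Data.Sum using (_⊎_; inj₁; inj₂; map₁)
open import Data.Unit using (tt)
open import Data.Vec using (Vec; []; _∷_; lookup)
open import Data.Vec.Properties using (≡-dec)
open import Relation.Nullary using (yes; no)
open import Relation.Binary.PropositionalEquality
  using (_≡_; refl; sym; cong; cong₂; subst; subst₂; module ≡-Reasoning)

ℕtoℚ≡mkℚ : ∀ k → ℕtoℚ k ≡ mkℚ (+ k) 0 (Coprimality.sym (Coprimality.1-coprimeTo k))
ℕtoℚ≡mkℚ k = ℚ.normalize-coprime (Coprimality.sym (Coprimality.1-coprimeTo k))

ℕtoℚ-mono-≤ : ∀ {j k} → j ≤ k → ℕtoℚ j ℚ.≤ ℕtoℚ k
ℕtoℚ-mono-≤ {j} {k} j≤k rewrite ℕtoℚ≡mkℚ j | ℕtoℚ≡mkℚ k =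
  ℚ.*≤* (subst₂ ℤ._≤_ (sym (ℤ.*-identityʳ (+ j))) (sym (ℤ.*-identityʳ (+ k))) (ℤ.+≤+ j≤k))

p≤p+q : ∀ p {q} → 0ℚ ℚ.≤ q → p ℚ.≤ p ℚ.+ q
p≤p+q p {q} 0≤q = subst (ℚ._≤ p ℚ.+ q) (ℚ.+-identityʳ p) (ℚ.+-monoʳ-≤ p 0≤q)

0≤1-t : ∀ {t} → t ℚ.≤ 1ℚ → 0ℚ ℚ.≤ 1ℚ ℚ.- t
0≤1-t {t} t≤1 = subst (ℚ._≤ 1ℚ ℚ.- t) (ℚ.+-inverseʳ t) (ℚ.+-monoˡ-≤ (ℚ.- t) t≤1)

NonExpanding : (G H : Graph) → (V G → V H) → Set
NonExpanding G H f = ∀ {u w} → Adj G u w → f u ≡ f w ⊎ Adj H (f u) (f w)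

module NonExpandingMap {G H : Graph} (f : V G → V H) (nonExpanding : NonExpanding G H f) where

  walk-map : ∀ {u v k} → Walk G u v k → ∃ λ k′ → k′ ≤ k × Walk H (f u) (f v) k′
  walk-map nil = 0 , z≤n , nil
  walk-map (cons u~w walk) with walk-map walk | nonExpanding u~w
  ... | k′ , k′≤k , walk′ | inj₁ fu≡fw =
    k′ , m≤n⇒m≤1+n k′≤k , subst (λ x → Walk H x (f _) k′) (sym fu≡fw) walk′
  ... | k′ , k′≤k , walk′ | inj₂ fu~fw = suc k′ , s≤s k′≤k , cons fu~fw walk′

  walk-map-offset : ∀ {u v k} {s ρ : ℚ} → Walk G u v k → ℕtoℚ k ℚ.+ s ℚ.≤ ρ →
                    ∃ λ k′ → Walk H (f u) (f v) k′ × (ℕtoℚ k′ ℚ.+ s ℚ.≤ ρ)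
  walk-map-offset {s = s} walk bound with walk-map walk
  ... | k′ , k′≤k , walk′ = k′ , walk′ , ℚ.≤-trans (ℚ.+-monoˡ-≤ s (ℕtoℚ-mono-≤ k′≤k)) bound

  walk-map-dropOffset : ∀ {u v k} {s ρ : ℚ} → 0ℚ ℚ.≤ s → Walk G u v k →
                        ℕtoℚ k ℚ.+ s ℚ.≤ ρ → ∃ λ k′ → Walk H (f u) (f v) k′ × (ℕtoℚ k′ ℚ.≤ ρ)
  walk-map-dropOffset 0≤s walk bound with walk-map walk
  ... | k′ , k′≤k , walk′ =
    k′ , walk′ , ℚ.≤-trans (ℚ.≤-trans (ℕtoℚ-mono-≤ k′≤k) (p≤p+q _ 0≤s)) bound

  point-map : Point G → Point H
  point-map (vtx u) = vtx (f u)
  point-map (onEdge a b a~b t 0≤t t≤1) with nonExpanding a~b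
  ... | inj₁ _    = vtx (f a)
  ... | inj₂ fa~fb = onEdge (f a) (f b) fa~fb t 0≤t t≤1

  within-map : ∀ {v p ρ} → Within G v p ρ → Within H (f v) (point-map p) ρ
  within-map {p = vtx u} (k , walk , bound) with walk-map walk
  ... | k′ , k′≤k , walk′ = k′ , walk′ , ℚ.≤-trans (ℕtoℚ-mono-≤ k′≤k) bound
  within-map {v} {p = onEdge a b a~b t 0≤t t≤1} within with nonExpanding a~b | within
  ... | inj₁ _     | inj₁ (k , walk , bound) = walk-map-dropOffset 0≤t walk bound
  ... | inj₁ fa≡fb | inj₂ (k , walk , bound) with walk-map-dropOffset (0≤1-t t≤1) walk bound
  ...   | k′ , walk′ , bound′ = k′ , subst (λ x → Walk H (f v) x k′) (sym fa≡fb) walk′ , bound′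
  within-map {v} {p = onEdge a b a~b t 0≤t t≤1} within
      | inj₂ _     | inj₁ (k , walk , bound) = inj₁ (walk-map-offset walk bound)
  within-map {v} {p = onEdge a b a~b t 0≤t t≤1} within
      | inj₂ _     | inj₂ (k , walk , bound) = inj₂ (walk-map-offset walk bound)

  nonEmpty-map : ∀ σ → NonEmpty σ → NonEmpty (map f σ)
  nonEmpty-map (_ ∷ _) _ = tt

  isCechSimplex-map : ∀ {r} σ → IsCechSimplex G r σ → IsCechSimplex H r (map f σ)
  isCechSimplex-map σ (nonEmpty , p , withinAll) =
    nonEmpty-map σ nonEmpty , point-map p , map⁺ (All.map within-map withinAll)

diffCount-∷-≡ : ∀ {n} x (xs ys : Vec Bool n) → diffCount (x ∷ xs) (x ∷ ys) ≡ diffCount xs ys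
diffCount-∷-≡ x xs ys with x Bool.≟ x
... | yes _  = refl
... | no x≢x = ⊥-elim (x≢x refl)

diffCount-∷-≤ : ∀ {n} x y (xs ys : Vec Bool n) → diffCount xs ys ≤ diffCount (x ∷ xs) (y ∷ ys)
diffCount-∷-≤ x y xs ys with x Bool.≟ y
... | yes _ = ≤-refl
... | no _  = m≤n⇒m≤1+n ≤-refl

diffCount-∷-mono-≤ : ∀ {n} x y {xs ys xs′ ys′ : Vec Bool n} → diffCount xs ys ≤ diffCount xs′ ys′ →
                     diffCount (x ∷ xs) (y ∷ ys) ≤ diffCount (x ∷ xs′) (y ∷ ys′)
diffCount-∷-mono-≤ x y d≤d′ with x Bool.≟ y
... | yes _ = d≤d′
... | no _  = s≤s d≤d′

diffCount≡0⇒≡ : ∀ {n} (xs ys : Vec Bool n) → diffCount xs ys ≡ 0 → xs ≡ ys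
diffCount≡0⇒≡ []       []       _ = refl
diffCount≡0⇒≡ (x ∷ xs) (y ∷ ys) d≡0 with x Bool.≟ y
diffCount≡0⇒≡ (x ∷ xs) (x ∷ ys) d≡0 | yes refl = cong (x ∷_) (diffCount≡0⇒≡ xs ys d≡0)
diffCount≡0⇒≡ (x ∷ xs) (y ∷ ys) () | no _

project : ∀ {n} → Subset n → Vec Bool n → Vec Bool n → Vec Bool n
project []           []       []       = []
project (fixed ∷ fs) (c ∷ cs) (x ∷ xs) = (if fixed then c else x) ∷ project fs cs xs

lookup-project : ∀ {n} (fixed : Subset n) val xs i →
  lookup (project fixed val xs) i ≡ (if lookup fixed i then lookup val i else lookup xs i)
lookup-project (_ ∷ _)  (_ ∷ _)  (_ ∷ _)  Fin.zero    = refl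
lookup-project (_ ∷ fs) (_ ∷ cs) (_ ∷ xs) (Fin.suc i) = lookup-project fs cs xs i

project-idempotent : ∀ {n} (fixed : Subset n) val xs →
  project fixed val (project fixed val xs) ≡ project fixed val xs
project-idempotent []            []       []       = refl
project-idempotent (true ∷ fs)  (c ∷ cs) (_ ∷ xs) = cong (c ∷_) (project-idempotent fs cs xs)
project-idempotent (false ∷ fs) (_ ∷ cs) (x ∷ xs) = cong (x ∷_) (project-idempotent fs cs xs)

project≡⇒inCube : ∀ {n} (fixed : Subset n) val xs → project fixed val xs ≡ xs → InCube fixed val xs
project≡⇒inCube fixed val xs project≡ i fixedᵢ = begin
  lookup xs i                                                  ≡⟨ cong (λ ys → lookup ys i) project≡ ⟨
  lookup (project fixed val xs) i                              ≡⟨ lookup-project fixed val xs i ⟩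
  (if lookup fixed i then lookup val i else lookup xs i)       ≡⟨ cong (if_then _ else _) fixedᵢ ⟩
  lookup val i                                                 ∎
  where open ≡-Reasoning

inCube⇒project≡ : ∀ {n} (fixed : Subset n) val xs → InCube fixed val xs → project fixed val xs ≡ xs
inCube⇒project≡ []            []       []       _      = refl
inCube⇒project≡ (true ∷ fs)  (c ∷ cs) (x ∷ xs) inCube =
  cong₂ _∷_ (sym (inCube Fin.zero refl)) (inCube⇒project≡ fs cs xs (λ i → inCube (Fin.suc i)))
inCube⇒project≡ (false ∷ fs) (c ∷ cs) (x ∷ xs) inCube =
  cong (x ∷_) (inCube⇒project≡ fs cs xs (λ i → inCube (Fin.suc i)))

diffCount-project-≤ : ∀ {n} (fixed : Subset n) val xs ys →
  diffCount (project fixed val xs) (project fixed val ys) ≤ diffCount xs ys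
diffCount-project-≤ []            []       []       []       = ≤-refl
diffCount-project-≤ (true ∷ fs)  (c ∷ cs) (x ∷ xs) (y ∷ ys)
  rewrite diffCount-∷-≡ c (project fs cs xs) (project fs cs ys) =
  ≤-trans (diffCount-project-≤ fs cs xs ys) (diffCount-∷-≤ x y xs ys)
diffCount-project-≤ (false ∷ fs) (c ∷ cs) (x ∷ xs) (y ∷ ys) =
  diffCount-∷-mono-≤ x y (diffCount-project-≤ fs cs xs ys)

project-nonExpanding : ∀ {n} (fixed : Subset n) val {xs ys} → diffCount xs ys ≡ 1 →
  project fixed val xs ≡ project fixed val ys ⊎ diffCount (project fixed val xs) (project fixed val ys) ≡ 1
project-nonExpanding fixed val {xs} {ys} d≡1 = map₁ (diffCount≡0⇒≡ _ _) (n≤1⇒n≡0∨n≡1 d′≤1)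
  where
  d′≤1 : diffCount (project fixed val xs) (project fixed val ys) ≤ 1
  d′≤1 = subst (diffCount (project fixed val xs) (project fixed val ys) ≤_) d≡1
               (diffCount-project-≤ fixed val xs ys)

module CubeProjection {n : ℕ} (fixed : Subset n) (val : Vec Bool n) where

  Q : Graph
  Q = CubeSubgraph fixed val

  -- The membership proof is manufactured from the equation project xs ≡ xs, which has
  -- unique proofs (Vec Bool has decidable equality), so vertices of Q with the same
  -- underlying vector are equal without appeal to function extensionality.
  toVertex : (xs : Vec Bool n) → project fixed val xs ≡ xs → V Q
  toVertex xs project≡ = xs , project≡⇒inCube fixed val xs project≡

  toVertex-cong : ∀ {xs ys} → xs ≡ ys →
    (p : project fixed val xs ≡ xs) (q : project fixed val ys ≡ ys) → toVertex xs p ≡ toVertex ys q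
  toVertex-cong refl p q = cong (toVertex _) (≡-irrelevant p q)
    where open Decidable⇒UIP (≡-dec Bool._≟_)

  toCube : Vec Bool n → V Q
  toCube xs = toVertex (project fixed val xs) (project-idempotent fixed val xs)

  toCube-nonExpanding : NonExpanding (Hypercube n) Q toCube
  toCube-nonExpanding xs~ys with project-nonExpanding fixed val xs~ys
  ... | inj₁ project≡ =
    inj₁ (toVertex-cong project≡ (project-idempotent fixed val _) (project-idempotent fixed val _))
  ... | inj₂ adjacent = inj₂ adjacent

  cubeRetraction : (r : ℚ) → CubeRetraction fixed val r
  cubeRetraction r = record
    { f          = toCube
    ; simplicial = λ σ → NonExpandingMap.isCechSimplex-map toCube toCube-nonExpanding {r} σ
    ; retract    = λ (xs , inCube) → inCube⇒project≡ fixed val xs inCube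
    }

lemma5p7 : (n m : ℕ) → m ≤ n → (fixed : Subset n) → ∣ fixed ∣ ≡ n ∸ m →
    (val : Vec Bool n) → CubeRetraction fixed val ((+ 3) / 1)
lemma5p7 _ _ _ fixed _ val = CubeProjection.cubeRetraction fixed val _
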